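{- If $G$ is a $[z,r;g]$-mixed cage, then $G$ is strongly connected, i.e. for every two vertices $u,v$ of $G$ there is a $uv$-path and a $vu$-path in $G$.
   Context: A mixed graph is a finite simple graph that may contain both (undirected) edges and (directed) arcs, with no multiple edges or arcs. It is $z$-regular by arcs and $r$-regular by edges if every vertex is the head of exactly $z$ arcs, the tail of exactly $z$ arcs, and is incident with exactly $r$ edges. Paths and cycles are sequences of vertices where consecutive vertices are joined by an edge or by an arc traversed in its direction; the girth is the length of a shortest cycle. A $[z,r;g]$-mixed graph is a mixed graph that is $z$-regular by arcs, $r$-regular by edges and has girth $g$; a $[z,r;g]$-mixed cage is a $[z,r;g]$-mixed graph of minimum order. -}

module Defs where

open import Data.Nat using (ℕ; zero; suc; _≤_)
open import Data.Bool using (Bool; true; false)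
open import Data.Fin using (Fin; zero; suc; inject₁; fromℕ)
open import Data.Fin.Subset using (∣_∣)
open import Data.Vec using (tabulate)
open import Data.Product using (Σ; _×_; _,_)
open import Data.Sum using (_⊎_)
open import Function.Definitions using (Injective)
open import Relation.Binary.PropositionalEquality using (_≡_)
open import Relation.Nullary using (¬_)

-- A finite mixed graph on vertex set Fin order.
-- edge u v = true : there is an (undirected) edge {u,v}
-- arc  u v = true : there is an arc from u (tail) to v (head)
record MixedGraph : Set where
  field
    order     : ℕ
    edge      : Fin order → Fin order → Bool
    arc       : Fin order → Fin order → Bool
    edge-sym  : ∀ u v → edge u v ≡ true → edge v u ≡ true
    edge-irr  : ∀ u → edge u u ≡ false
    arc-irr   : ∀ u → arc u u ≡ false
    -- simplicity: no multiple edges/arcs between the same pair of vertices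
    arc-asym  : ∀ u v → arc u v ≡ true → arc v u ≡ false
    arc-edge  : ∀ u v → arc u v ≡ true → edge u v ≡ false

open MixedGraph public

edgeDeg : (G : MixedGraph) → Fin (order G) → ℕ
edgeDeg G u = ∣ tabulate (λ v → edge G u v) ∣

outDeg : (G : MixedGraph) → Fin (order G) → ℕ
outDeg G u = ∣ tabulate (λ v → arc G u v) ∣

inDeg : (G : MixedGraph) → Fin (order G) → ℕ
inDeg G u = ∣ tabulate (λ v → arc G v u) ∣

Step : (G : MixedGraph) → Fin (order G) → Fin (order G) → Set
Step G u v = (edge G u v ≡ true) ⊎ (arc G u v ≡ true)

record Path (G : MixedGraph) (u v : Fin (order G)) : Set where
  field
    len    : ℕ
    vert   : Fin (suc len) → Fin (order G)
    inj    : Injective _≡_ _≡_ vert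
    start  : vert zero ≡ u
    end    : vert (fromℕ len) ≡ v
    steps  : ∀ (i : Fin len) → Step G (vert (inject₁ i)) (vert (suc i))

record Cycle (G : MixedGraph) (k : ℕ) : Set where
  field
    m      : ℕ
    len≡   : k ≡ suc m
    len≥3  : 3 ≤ k
    vert   : Fin (suc m) → Fin (order G)
    inj    : Injective _≡_ _≡_ vert
    steps  : ∀ (i : Fin m) → Step G (vert (inject₁ i)) (vert (suc i))
    close  : Step G (vert (fromℕ m)) (vert zero)

HasGirth : MixedGraph → ℕ → Set
HasGirth G g = Cycle G g × (∀ k → Cycle G k → g ≤ k)

IsMixed : ℕ → ℕ → ℕ → MixedGraph → Set
IsMixed z r g G =
  (∀ u → inDeg G u ≡ z) × (∀ u → outDeg G u ≡ z) × (∀ u → edgeDeg G u ≡ r) × HasGirth G g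

IsMixedCage : ℕ → ℕ → ℕ → MixedGraph → Set
IsMixedCage z r g G = IsMixed z r g G × (∀ H → IsMixed z r g H → order G ≤ order H)

StronglyConnected : MixedGraph → Set
StronglyConnected G = ∀ (u v : Fin (order G)) → Path G u v × Path G v u

-- Fix a shortest cycle C of the cage G, and let S be the set of vertices
-- reachable from a vertex s. S is closed under leaving steps, and then also
-- under entering ones: for edges by symmetry, and for arcs by double counting,
-- since the arcs with tail in S all have head in S, while in- and out-degrees
-- agree. So S and its complement both induce [z,r;g]-mixed graphs as soon as
-- they meet C, and minimality of G makes whichever of them meets C the whole
-- graph. As s ∈ S, that is S: every vertex reaches every other.
module Submission where

open import Defs
open import Level using (Level)
open import Data.Nat using (ℕ; zero; suc; _+_; _*_; _≤_; _<_; z≤n; s≤s)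
open import Data.Nat.Properties
  using ( +-*-semiring; ≤-refl; ≤-reflexive; ≤-trans; ≤-antisym; <⇒≤; <⇒≱
        ; +-mono-≤; +-monoʳ-≤; +-monoˡ-≤; +-cancelˡ-≤; +-cancelʳ-≤; m≤n⇒m≤1+n)
open import Data.Bool using (Bool; true; false)
import Data.Bool as Bool
open import Data.Fin using (Fin; zero; suc; inject₁; fromℕ; _≟_)
open import Data.Fin.Properties using (suc-injective; any?; injective⇒≤)
open import Data.Fin.Induction using (<-weakInduction)
open import Data.Fin.Subset using (∣_∣)
open import Data.Vec using (tabulate)
open import Data.Product using (Σ; ∃; _×_; _,_; proj₁; proj₂)
open import Data.Sum using (inj₁; inj₂)
open import Function using (_∘_)
open import Function.Definitions using (Injective)
open import Relation.Binary.PropositionalEquality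
open import Relation.Nullary using (Dec; yes; no; ¬_; ¬?; does; contradiction; _×-dec_; _⊎-dec_; map′)
open import Relation.Unary using (Pred; Decidable)

open import Algebra.Properties.Semiring.Sum +-*-semiring using (sum; sum-cong-≗; ∑-comm; *-distribˡ-sum)

private variable
  ℓ : Level
  n : ℕ

indicator : Bool → ℕ
indicator true  = 1
indicator false = 0

∣tabulate∣≡sum : (b : Fin n → Bool) → ∣ tabulate b ∣ ≡ sum (indicator ∘ b)
∣tabulate∣≡sum {zero}  b = refl
∣tabulate∣≡sum {suc n} b with b zero
... | true  = cong suc (∣tabulate∣≡sum (b ∘ suc))
... | false = ∣tabulate∣≡sum (b ∘ suc)

sum-mono-≤ : {f g : Fin n → ℕ} → (∀ i → f i ≤ g i) → sum f ≤ sum g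
sum-mono-≤ {zero}  f≤g = z≤n
sum-mono-≤ {suc n} f≤g = +-mono-≤ (f≤g zero) (sum-mono-≤ (f≤g ∘ suc))

sum-mono-≤-rigid : {f g : Fin n → ℕ} → (∀ i → f i ≤ g i) → sum f ≡ sum g → ∀ i → f i ≡ g i
sum-mono-≤-rigid {suc n} {f} {g} f≤g ∑f≡∑g zero = ≤-antisym (f≤g zero)
  (+-cancelʳ-≤ _ _ _ (≤-trans (≤-reflexive (sym ∑f≡∑g)) (+-monoʳ-≤ (f zero) (sum-mono-≤ (f≤g ∘ suc)))))
sum-mono-≤-rigid {suc n} {f} {g} f≤g ∑f≡∑g (suc i) = sum-mono-≤-rigid (f≤g ∘ suc)
  (≤-antisym (sum-mono-≤ (f≤g ∘ suc))
    (+-cancelˡ-≤ (g zero) _ _ (≤-trans (≤-reflexive (sym ∑f≡∑g)) (+-monoˡ-≤ _ (f≤g zero))))) i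

size : {P : Pred (Fin n) ℓ} → Decidable P → ℕ
size P? = sum (λ x → indicator (does (P? x)))

enum : {P : Pred (Fin n) ℓ} (P? : Decidable P) → Fin (size P?) → Fin n
enum {suc n} P? j with P? zero
enum {suc n} P? zero    | yes _ = zero
enum {suc n} P? (suc j) | yes _ = suc (enum (P? ∘ suc) j)
enum {suc n} P? j       | no _  = suc (enum (P? ∘ suc) j)

enum-∈ : {P : Pred (Fin n) ℓ} (P? : Decidable P) → ∀ j → P (enum P? j)
enum-∈ {suc n} P? j with P? zero
enum-∈ {suc n} P? zero    | yes p = p
enum-∈ {suc n} P? (suc j) | yes _ = enum-∈ (P? ∘ suc) j
enum-∈ {suc n} P? j       | no _  = enum-∈ (P? ∘ suc) j

enum-injective : {P : Pred (Fin n) ℓ} (P? : Decidable P) → Injective _≡_ _≡_ (enum P?)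
enum-injective {suc n} P? {i} {j} e with P? zero
enum-injective {suc n} P? {zero}  {zero}  e | yes _ = refl
enum-injective {suc n} P? {suc i} {suc j} e | yes _ = cong suc (enum-injective (P? ∘ suc) (suc-injective e))
enum-injective {suc n} P? {i}     {j}     e | no _  = enum-injective (P? ∘ suc) (suc-injective e)

enum-surjective : {P : Pred (Fin n) ℓ} (P? : Decidable P) → ∀ {x} → P x → ∃ λ j → enum P? j ≡ x
enum-surjective {suc n} P? {x} px with P? zero
enum-surjective {suc n} P? {zero}  px | yes _  = zero , refl
enum-surjective {suc n} P? {zero}  px | no ¬p  = contradiction px ¬p
enum-surjective {suc n} P? {suc x} px | yes _ with j , e ← enum-surjective (P? ∘ suc) px = suc j , cong suc e
enum-surjective {suc n} P? {suc x} px | no _  with j , e ← enum-surjective (P? ∘ suc) px = j , cong suc e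

sum-enum : {P : Pred (Fin n) ℓ} (P? : Decidable P) (f : Fin n → ℕ) → (∀ x → ¬ P x → f x ≡ 0) →
           sum f ≡ sum (f ∘ enum P?)
sum-enum {zero}  P? f f0 = refl
sum-enum {suc n} P? f f0 with P? zero
... | yes _  = cong (f zero +_) (sum-enum (P? ∘ suc) (f ∘ suc) (f0 ∘ suc))
... | no ¬p = cong₂ _+_ (f0 zero ¬p) (sum-enum (P? ∘ suc) (f ∘ suc) (f0 ∘ suc))

size≤n : {P : Pred (Fin n) ℓ} (P? : Decidable P) → size P? ≤ n
size≤n {zero}  P? = z≤n
size≤n {suc n} P? with P? zero
... | yes _ = s≤s (size≤n (P? ∘ suc))
... | no _  = m≤n⇒m≤1+n (size≤n (P? ∘ suc))

size<n : {P : Pred (Fin n) ℓ} (P? : Decidable P) → ∀ {x} → ¬ P x → size P? < n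
size<n {suc n} P? {x} ¬px with P? zero
size<n {suc n} P? {zero}  ¬px | yes p = contradiction p ¬px
size<n {suc n} P? {suc x} ¬px | yes _ = s≤s (size<n (P? ∘ suc) ¬px)
size<n {suc n} P? {x}     ¬px | no _  = s≤s (size≤n (P? ∘ suc))

∣tabulate∘enum∣ : {P : Pred (Fin n) ℓ} (P? : Decidable P) (b : Fin n → Bool) →
                  (∀ x → b x ≡ true → P x) → ∣ tabulate (b ∘ enum P?) ∣ ≡ ∣ tabulate b ∣
∣tabulate∘enum∣ {P = P} P? b b⊆P = begin
  ∣ tabulate (b ∘ enum P?) ∣        ≡⟨ ∣tabulate∣≡sum (b ∘ enum P?) ⟩
  sum (indicator ∘ b ∘ enum P?)    ≡⟨ sum-enum P? (indicator ∘ b) vanishes ⟨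
  sum (indicator ∘ b)              ≡⟨ ∣tabulate∣≡sum b ⟨
  ∣ tabulate b ∣                    ∎
  where
  open ≡-Reasoning
  vanishes : ∀ x → ¬ P x → indicator (b x) ≡ 0
  vanishes x ¬px with b x in bx
  ... | true  = contradiction (b⊆P x bx) ¬px
  ... | false = refl

module _ (A : Fin n → Fin n → Bool)
         (balanced : ∀ u → ∣ tabulate (A u) ∣ ≡ ∣ tabulate (λ w → A w u) ∣)
         {P : Pred (Fin n) ℓ} (P? : Decidable P)
         (out-closed : ∀ {u v} → P u → A u v ≡ true → P v) where

  private
    ρ : Fin n → ℕ
    ρ x = indicator (does (P? x))

    a : Fin n → Fin n → ℕ
    a u v = indicator (A u v)

    tail-weight≤head-weight : ∀ u v → ρ u * a u v ≤ ρ v * a u v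
    tail-weight≤head-weight u v with P? u | A u v in uv
    ... | no _  | _     = z≤n
    ... | yes _ | false = z≤n
    ... | yes p | true with P? v
    ...   | yes _ = ≤-refl
    ...   | no ¬q = contradiction (out-closed p uv) ¬q

    -- arcs with tail in P and arcs with head in P both number the total degree of P
    double-count : sum (λ u → sum (λ v → ρ u * a u v)) ≡ sum (λ u → sum (λ v → ρ v * a u v))
    double-count = begin
      sum (λ u → sum (λ v → ρ u * a u v))  ≡⟨ sum-cong-≗ (λ u → *-distribˡ-sum (ρ u) (a u)) ⟨
      sum (λ u → ρ u * sum (a u))          ≡⟨ sum-cong-≗ (λ u → cong (ρ u *_) (degree u)) ⟩
      sum (λ u → ρ u * sum (λ w → a w u))  ≡⟨ sum-cong-≗ (λ u → *-distribˡ-sum (ρ u) (λ w → a w u)) ⟩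
      sum (λ u → sum (λ w → ρ u * a w u))  ≡⟨ ∑-comm (λ u w → ρ u * a w u) ⟩
      sum (λ w → sum (λ u → ρ u * a w u))  ∎
      where
      open ≡-Reasoning
      degree : ∀ u → sum (a u) ≡ sum (λ w → a w u)
      degree u = begin
        sum (a u)                    ≡⟨ ∣tabulate∣≡sum (A u) ⟨
        ∣ tabulate (A u) ∣           ≡⟨ balanced u ⟩
        ∣ tabulate (λ w → A w u) ∣   ≡⟨ ∣tabulate∣≡sum (λ w → A w u) ⟩
        sum (λ w → a w u)            ∎

    tail-weight≡head-weight : ∀ u v → ρ u * a u v ≡ ρ v * a u v
    tail-weight≡head-weight u = sum-mono-≤-rigid (tail-weight≤head-weight u)
      (sum-mono-≤-rigid (λ u → sum-mono-≤ (tail-weight≤head-weight u)) double-count u)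

  in-closed : ∀ {u v} → P v → A u v ≡ true → P u
  in-closed {u} {v} q uv with P? u | P? v | tail-weight≡head-weight u v
  ... | yes p | _     | _   = p
  ... | no _  | no ¬q | _   = contradiction q ¬q
  ... | no _  | yes _ | 0≡1 rewrite uv with () ← 0≡1

StepClosed : (G : MixedGraph) → Pred (Fin (order G)) ℓ → Set ℓ
StepClosed G P = ∀ {u v} → P u → Step G u v → P v

module _ (G : MixedGraph) where

  private
    V : Set
    V = Fin (order G)

  step? : ∀ u v → Dec (Step G u v)
  step? u v = (edge G u v Bool.≟ true) ⊎-dec (arc G u v Bool.≟ true)

  data Walk : V → V → Set where
    []  : ∀ {u} → Walk u u
    _∷_ : ∀ {u v w} → Step G u v → Walk v w → Walk u w

  length : ∀ {u v} → Walk u v → ℕ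
  length []      = 0
  length (_ ∷ p) = suc (length p)

  _++_ : ∀ {u v w} → Walk u v → Walk v w → Walk u w
  []      ++ q = q
  (s ∷ p) ++ q = s ∷ (p ++ q)

  _∷ʳ_ : ∀ {u v w} → Walk u v → Step G v w → Walk u w
  p ∷ʳ s = p ++ (s ∷ [])

  Reach : ℕ → V → V → Set
  Reach k u v = Σ (Walk u v) λ p → length p ≤ k

  reach? : ∀ k u v → Dec (Reach k u v)
  reach? k u v with u ≟ v
  ... | yes refl = yes ([] , z≤n)
  reach? zero    u v | no u≢v = no λ { ([] , _) → u≢v refl }
  reach? (suc k) u v | no u≢v = map′ extend shorten (any? λ w → step? u w ×-dec reach? k w v)
    where
    extend : (∃ λ w → Step G u w × Reach k w v) → Reach (suc k) u v
    extend (w , s , p , |p|≤k) = s ∷ p , s≤s |p|≤k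
    shorten : Reach (suc k) u v → ∃ λ w → Step G u w × Reach k w v
    shorten ([] , _) = contradiction refl u≢v
    shorten (s ∷ p , s≤s |p|≤k) = _ , s , p , |p|≤k

  trivialPath : ∀ u → Path G u u
  trivialPath u = record
    { len = 0 ; vert = λ _ → u ; inj = λ { {zero} {zero} _ → refl }
    ; start = refl ; end = refl ; steps = λ () }

  suffix : ∀ {u v} (p : Path G u v) (i : Fin (suc (Path.len p))) → Path G (Path.vert p i) v
  suffix p zero = record { Path p hiding (start) ; start = refl }
  suffix record { len = suc l ; vert = f ; inj = inj ; end = end ; steps = steps } (suc i) =
    suffix (record { len = l ; vert = f ∘ suc ; inj = suc-injective ∘ inj
                   ; start = refl ; end = end ; steps = steps ∘ suc }) i

  prepend : ∀ {u v w} → Step G u v → (p : Path G v w) → (∀ i → Path.vert p i ≢ u) → Path G u w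
  prepend {u} s p u∉p = record
    { len = suc (Path.len p) ; vert = vert ; inj = inj
    ; start = refl ; end = Path.end p ; steps = steps }
    where
    vert : Fin (suc (suc (Path.len p))) → V
    vert zero    = u
    vert (suc i) = Path.vert p i
    inj : ∀ {i j} → vert i ≡ vert j → i ≡ j
    inj {zero}  {zero}  _ = refl
    inj {zero}  {suc j} e = contradiction (sym e) (u∉p j)
    inj {suc i} {zero}  e = contradiction e (u∉p i)
    inj {suc i} {suc j} e = cong suc (Path.inj p e)
    steps : ∀ i → Step G (vert (inject₁ i)) (vert (suc i))
    steps zero    = subst (Step G u) (sym (Path.start p)) s
    steps (suc i) = Path.steps p i

  toPath : ∀ {u v} → Walk u v → Path G u v
  toPath {u} []      = trivialPath u
  toPath {u} (s ∷ p) with q ← toPath p | any? (λ i → Path.vert q i ≟ u)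
  ... | yes (i , qᵢ≡u) = subst (λ x → Path G x _) qᵢ≡u (suffix q i)
  ... | no u∉q         = prepend s q (λ i qᵢ≡u → u∉q (i , qᵢ≡u))

  walkAlong : ∀ l (f : Fin (suc l) → V) → (∀ i → Step G (f (inject₁ i)) (f (suc i))) →
              Σ (Walk (f zero) (f (fromℕ l))) λ w → length w ≡ l
  walkAlong zero    f steps = [] , refl
  walkAlong (suc l) f steps with w , |w|≡l ← walkAlong l (f ∘ suc) (steps ∘ suc) =
    steps zero ∷ w , cong suc |w|≡l

  toWalk : ∀ {u v} (p : Path G u v) → Σ (Walk u v) λ w → length w ≡ Path.len p
  toWalk record { len = l ; vert = f ; start = refl ; end = refl ; steps = steps } = walkAlong l f steps

  -- a path has distinct vertices, so fewer steps than there are vertices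
  reach-order : ∀ {u v} → Walk u v → Reach (order G) u v
  reach-order p with w , |w|≡|p′| ← toWalk (toPath p) =
    w , ≤-trans (≤-reflexive |w|≡|p′|) (<⇒≤ (injective⇒≤ (Path.inj (toPath p))))

  reach-closed : ∀ s → StepClosed G (Reach (order G) s)
  reach-closed s (p , _) st = reach-order (p ∷ʳ st)

module _ (G : MixedGraph) (balanced : ∀ u → outDeg G u ≡ inDeg G u)
         {P : Pred (Fin (order G)) ℓ} (P? : Decidable P) (closed : StepClosed G P) where

  entry-closed : ∀ {u v} → P v → Step G u v → P u
  entry-closed pv (inj₁ uv) = closed pv (inj₁ (edge-sym G _ _ uv))
  entry-closed pv (inj₂ uv) = in-closed (arc G) balanced P? (λ pu a → closed pu (inj₂ a)) pv uv

  ∁-closed : StepClosed G (¬_ ∘ P)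
  ∁-closed ¬pu st pv = ¬pu (entry-closed pv st)

isMixed⇒balanced : ∀ {z r g G} → IsMixed z r g G → ∀ u → outDeg G u ≡ inDeg G u
isMixed⇒balanced (inD , outD , _) u = trans (outD u) (sym (inD u))

module Induced (G : MixedGraph) {P : Pred (Fin (order G)) ℓ} (P? : Decidable P) where

  private
    e : Fin (size P?) → Fin (order G)
    e = enum P?

  induced : MixedGraph
  induced = record
    { order    = size P?
    ; edge     = λ i j → edge G (e i) (e j)
    ; arc      = λ i j → arc G (e i) (e j)
    ; edge-sym = λ i j → edge-sym G (e i) (e j)
    ; edge-irr = edge-irr G ∘ e
    ; arc-irr  = arc-irr G ∘ e
    ; arc-asym = λ i j → arc-asym G (e i) (e j)
    ; arc-edge = λ i j → arc-edge G (e i) (e j)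
    }

  unrestrictCycle : ∀ {k} → Cycle induced k → Cycle G k
  unrestrictCycle C = record
    { m = m ; len≡ = len≡ ; len≥3 = len≥3
    ; vert = e ∘ vert ; inj = inj ∘ enum-injective P? ; steps = steps ; close = close }
    where open Cycle C

  restrictCycle : ∀ {k} (C : Cycle G k) → (∀ i → P (Cycle.vert C i)) → Cycle induced k
  restrictCycle C C⊆P = record
    { m = m ; len≡ = len≡ ; len≥3 = len≥3
    ; vert = proj₁ ∘ index
    ; inj = λ {i} {j} eq → inj (trans (sym (lift i)) (trans (cong e eq) (lift j)))
    ; steps = λ i → subst₂ (Step G) (sym (lift (inject₁ i))) (sym (lift (suc i))) (steps i)
    ; close = subst₂ (Step G) (sym (lift (fromℕ m))) (sym (lift zero)) close
    }
    where
    open Cycle C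
    index : ∀ i → ∃ λ j → e j ≡ vert i
    index i = enum-surjective P? (C⊆P i)
    lift : ∀ i → e (proj₁ (index i)) ≡ vert i
    lift = proj₂ ∘ index

  induced-isMixed : ∀ {z r g} → IsMixed z r g G → StepClosed G P →
                    (C : Cycle G g) → P (Cycle.vert C zero) → IsMixed z r g induced
  induced-isMixed {z} {r} mixed@(inD , outD , edgeD , _ , girth≤) closed C p =
    inD′ , outD′ , edgeD′ , restrictCycle C C⊆P , (λ k → girth≤ k ∘ unrestrictCycle)
    where
    inD′ : ∀ i → inDeg induced i ≡ z
    inD′ i = trans (∣tabulate∘enum∣ P? (λ x → arc G x (e i)) (λ x xi →
                      entry-closed G (isMixed⇒balanced mixed) P? closed (enum-∈ P? i) (inj₂ xi)))
                   (inD (e i))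
    outD′ : ∀ i → outDeg induced i ≡ z
    outD′ i = trans (∣tabulate∘enum∣ P? (arc G (e i)) (λ x ix → closed (enum-∈ P? i) (inj₂ ix))) (outD (e i))
    edgeD′ : ∀ i → edgeDeg induced i ≡ r
    edgeD′ i = trans (∣tabulate∘enum∣ P? (edge G (e i)) (λ x ix → closed (enum-∈ P? i) (inj₁ ix))) (edgeD (e i))
    C⊆P : ∀ i → P (Cycle.vert C i)
    C⊆P = <-weakInduction (P ∘ Cycle.vert C) p (λ i pᵢ → closed pᵢ (Cycle.steps C i))

open Induced using (induced; induced-isMixed)

cage-closed⇒total : ∀ {z r g G} → IsMixedCage z r g G →
                    {P : Pred (Fin (order G)) ℓ} (P? : Decidable P) → StepClosed G P →
                    (C : Cycle G g) → P (Cycle.vert C zero) → ∀ x → P x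
cage-closed⇒total {G = G} (mixed , minimal) P? closed C p x with P? x
... | yes px = px
... | no ¬px = contradiction (minimal (induced G P?) (induced-isMixed G P? mixed closed C p)) (<⇒≱ (size<n P? ¬px))

mainTheorem3 : ∀ (z r g : ℕ) (G : MixedGraph) → IsMixedCage z r g G → StronglyConnected G
mainTheorem3 z r g G cage@(mixed@(_ , _ , _ , C , _) , _) u v = connect u v , connect v u
  where
  reachable : ∀ s x → Reach G (order G) s x
  reachable s with reach? G (order G) s (Cycle.vert C zero)
  ... | yes s⇝C = cage-closed⇒total cage (reach? G _ s) (reach-closed G s) C s⇝C
  ... | no s↛C  = contradiction ([] , z≤n) (cage-closed⇒total cage (¬? ∘ reach? G _ s) ∁S-closed C s↛C s)
    where
    ∁S-closed : StepClosed G (¬_ ∘ Reach G (order G) s)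
    ∁S-closed = ∁-closed G (isMixed⇒balanced mixed) (reach? G _ s) (reach-closed G s)

  connect : ∀ s x → Path G s x
  connect s x = toPath G (proj₁ (reachable s x))
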